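{- Let $\Gamma$ be a conservative valued constraint language on a finite domain $D$ such that $G_\Gamma$ has no soft self-loop. For any $a,b,c\in D$, at most one of $ab|c$, $ca|b$, $bc|a$ holds. If $ab|c$ holds, then $(a,c),(b,c)\in\overline{M}$.
   Context: A weighted relation of arity $r$ on $D$ is a map $D^r\to\mathbb{Q}\cup\{\infty\}$; a relation has values in $\{0,\infty\}$ and is identified with the set of tuples mapped to $0$. $\mathrm{Feas}(\gamma)=\{\mathbf{x}:\gamma(\mathbf{x})<\infty\}$, $\mathrm{Opt}(\gamma)$ is the relation of tuples in $\mathrm{Feas}(\gamma)$ of minimum value. $\Gamma$ is conservative if it contains all unary weighted relations $D\to\{0,1\}$. $\mathcal{C}(\Gamma)$ is the smallest set of weighted relations on $D$ containing $\Gamma$, all unary weighted relations on $D$ and the binary equality relation on $D$, and closed under: $\mathrm{Feas}$ and $\mathrm{Opt}$; adding a unary weighted relation $\mu$ at a coordinate $i$ ($\gamma'(\mathbf{x})=\gamma(\mathbf{x})+\mu(x_i)$); minimisation at a coordinate; and join of binary $\gamma_1,\gamma_2$: $\gamma(x,y)=\min_{z\in D}(\gamma_1(u_1,v_1)+\gamma_2(u_2,v_2))$ with $\{u_1,v_1\}=\{x,z\}$, $\{u_2,v_2\}=\{y,z\}$ (either order). $G_\Gamma$ is the undirected graph (self-loops allowed) on vertices $(a,b)\in D^2$, $a\ne b$, with an edge $(a_1,b_1)-(a_2,b_2)$ iff there is a binary $\gamma\in\mathcal{C}(\Gamma)$ with $(a_1,b_2),(b_1,a_2)\in\mathrm{Feas}(\gamma)$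 and $\gamma(a_1,b_2)+\gamma(b_1,a_2)<\gamma(a_1,a_2)+\gamma(b_1,b_2)$; the edge is soft if some such $\gamma$ also has at least one of $(a_1,a_2),(b_1,b_2)$ in $\mathrm{Feas}(\gamma)$. $\overline{M}$ is the set of vertices with a self-loop. For $a,b,c\in D$, "$ab|c$ holds" means $a,b,c$ are pairwise distinct and there exists $(s,t)\in\overline{M}$ such that the binary relation $\{(a,s),(b,s),(c,t)\}$ belongs to $\mathcal{C}(\Gamma)$. -}

module Defs where

open import Data.Nat using (ℕ; suc)
open import Data.Fin using (Fin; zero; suc; _≟_; punchOut)
open import Data.Rational using (ℚ; 0ℚ; 1ℚ; _⊓_) renaming (_+_ to _+ℚ_; _<_ to _<ℚ_; _≤_ to _≤ℚ_)
open import Data.Bool using (Bool; true; false; if_then_else_; _∨_; _∧_)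
open import Data.List using (List; foldr; map)
open import Data.List.Base using ()
open import Data.Fin.Base using ()
open import Data.Product using (Σ; _×_; _,_; ∃)
open import Data.Sum using (_⊎_)
open import Data.Empty using (⊥)
open import Data.Unit using (⊤)
open import Relation.Nullary using (¬_; yes; no; Dec)
open import Relation.Nullary.Decidable using (⌊_⌋)
open import Relation.Binary.PropositionalEquality using (_≡_; _≢_)
open import Function.Bundles using (_⇔_)

data Ext : Set where
  fin : ℚ → Ext
  ∞   : Ext

infixl 6 _⊕_
_⊕_ : Ext → Ext → Ext
fin p ⊕ fin q = fin (p +ℚ q)
_     ⊕ _     = ∞

minE : Ext → Ext → Ext
minE (fin p) (fin q) = fin (p ⊓ q)
minE (fin p) ∞       = fin p
minE ∞       y       = y

_≤E_ : Ext → Ext → Set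
fin p ≤E fin q = p ≤ℚ q
fin p ≤E ∞     = ⊤
∞     ≤E fin q = ⊥
∞     ≤E ∞     = ⊤

_<E_ : Ext → Ext → Set
fin p <E fin q = p <ℚ q
fin p <E ∞     = ⊤
∞     <E _     = ⊥

IsFinite : Ext → Set
IsFinite (fin _) = ⊤
IsFinite ∞       = ⊥

Tuple : ℕ → ℕ → Set
Tuple n r = Fin r → Fin n

WRel : ℕ → ℕ → Set
WRel n r = Tuple n r → Ext

_∈Feas_ : ∀ {n r} → Tuple n r → WRel n r → Set
x ∈Feas γ = IsFinite (γ x)

Feas : ∀ {n r} → WRel n r → WRel n r
Feas γ x with γ x
... | fin _ = fin 0ℚ
... | ∞     = ∞

IsOptTuple : ∀ {n r} → WRel n r → Tuple n r → Set
IsOptTuple γ x = IsFinite (γ x) × (∀ y → γ x ≤E γ y)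

IsOptOf : ∀ {n r} → WRel n r → WRel n r → Set
IsOptOf γ γ' = ∀ x → (γ' x ≡ fin 0ℚ ⊎ γ' x ≡ ∞) × (γ' x ≡ fin 0ℚ ⇔ IsOptTuple γ x)

addUnary : ∀ {n r} → WRel n r → WRel n 1 → Fin r → WRel n r
addUnary γ μ i x = γ x ⊕ μ (λ _ → x i)

insertAt : ∀ {n r} → Fin (suc r) → Fin n → Tuple n r → Tuple n (suc r)
insertAt i d y j with i ≟ j
... | yes _  = d
... | no i≢j = y (punchOut i≢j)

allFin : (n : ℕ) → List (Fin n)
allFin n = Data.List.Base.tabulate (λ i → i)

-- minimum over the domain (min over empty set is ∞)
minOver : ∀ {n} → (Fin n → Ext) → Ext
minOver {n} f = foldr (λ d acc → minE (f d) acc) ∞ (allFin n)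

minimise : ∀ {n r} → WRel n (suc r) → Fin (suc r) → WRel n r
minimise γ i y = minOver (λ d → γ (insertAt i d y))

pair : ∀ {n} → Fin n → Fin n → Tuple n 2
pair a b zero       = a
pair a b (suc zero) = b

app2 : ∀ {n} → WRel n 2 → Fin n → Fin n → Ext
app2 γ a b = γ (pair a b)

app2o : ∀ {n} → Bool → WRel n 2 → Fin n → Fin n → Ext
app2o false γ u v = app2 γ u v
app2o true  γ u v = app2 γ v u

join : ∀ {n} → Bool → Bool → WRel n 2 → WRel n 2 → WRel n 2
join o₁ o₂ γ₁ γ₂ t = minOver (λ z → app2o o₁ γ₁ (t zero) z ⊕ app2o o₂ γ₂ (t (suc zero)) z)

eqRel : ∀ {n} → WRel n 2
eqRel t = if ⌊ t zero ≟ t (suc zero) ⌋ then fin 0ℚ else ∞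

Language : ℕ → Set₁
Language n = ∀ {r} → WRel n r → Set

Conservative : ∀ {n} → Language n → Set
Conservative {n} Γ = ∀ (μ : WRel n 1) → (∀ x → μ x ≡ fin 0ℚ ⊎ μ x ≡ fin 1ℚ) → Γ μ

data C {n : ℕ} (Γ : Language n) : ∀ {r} → WRel n r → Set where
  base     : ∀ {r} {γ : WRel n r} → Γ γ → C Γ γ
  unary    : (μ : WRel n 1) → C Γ μ
  equality : C Γ eqRel
  -- weighted relations are functions: membership is up to pointwise equality
  ext      : ∀ {r} {γ γ' : WRel n r} → C Γ γ → (∀ x → γ x ≡ γ' x) → C Γ γ'
  feas     : ∀ {r} {γ : WRel n r} → C Γ γ → C Γ (Feas γ)
  opt      : ∀ {r} {γ γ' : WRel n r} → C Γ γ → IsOptOf γ γ' → C Γ γ'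
  addU     : ∀ {r} {γ : WRel n r} → C Γ γ → (μ : WRel n 1) → (i : Fin r) →
             C Γ (addUnary γ μ i)
  minim    : ∀ {r} {γ : WRel n (suc r)} → C Γ γ → (i : Fin (suc r)) →
             C Γ (minimise γ i)
  joinC    : ∀ {γ₁ γ₂ : WRel n 2} → C Γ γ₁ → C Γ γ₂ → (o₁ o₂ : Bool) →
             C Γ (join o₁ o₂ γ₁ γ₂)

EdgeWitness : ∀ {n} → WRel n 2 → Fin n → Fin n → Fin n → Fin n → Set
EdgeWitness γ a₁ b₁ a₂ b₂ =
  IsFinite (app2 γ a₁ b₂) × IsFinite (app2 γ b₁ a₂) ×
  (app2 γ a₁ b₂ ⊕ app2 γ b₁ a₂) <E (app2 γ a₁ a₂ ⊕ app2 γ b₁ b₂)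

Edge : ∀ {n} → Language n → Fin n → Fin n → Fin n → Fin n → Set
Edge {n} Γ a₁ b₁ a₂ b₂ = a₁ ≢ b₁ × a₂ ≢ b₂ ×
  Σ (WRel n 2) (λ γ → C Γ γ × EdgeWitness γ a₁ b₁ a₂ b₂)

SoftEdge : ∀ {n} → Language n → Fin n → Fin n → Fin n → Fin n → Set
SoftEdge {n} Γ a₁ b₁ a₂ b₂ = a₁ ≢ b₁ × a₂ ≢ b₂ ×
  Σ (WRel n 2) (λ γ → C Γ γ × EdgeWitness γ a₁ b₁ a₂ b₂ ×
                       (IsFinite (app2 γ a₁ a₂) ⊎ IsFinite (app2 γ b₁ b₂)))

NoSoftSelfLoop : ∀ {n} → Language n → Set
NoSoftSelfLoop Γ = ∀ a b → ¬ SoftEdge Γ a b a b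

InMbar : ∀ {n} → Language n → Fin n → Fin n → Set
InMbar Γ s t = Edge Γ s t s t

threeRel : ∀ {n} → Fin n → Fin n → Fin n → Fin n → Fin n → WRel n 2
threeRel a b c s t p =
  if (⌊ p zero ≟ a ⌋ ∧ ⌊ p (suc zero) ≟ s ⌋) ∨
     (⌊ p zero ≟ b ⌋ ∧ ⌊ p (suc zero) ≟ s ⌋) ∨
     (⌊ p zero ≟ c ⌋ ∧ ⌊ p (suc zero) ≟ t ⌋)
  then fin 0ℚ else ∞

Split : ∀ {n} → Language n → Fin n → Fin n → Fin n → Set
Split {n} Γ a b c = a ≢ b × b ≢ c × a ≢ c ×
  Σ (Fin n) (λ s → Σ (Fin n) (λ t → InMbar Γ s t × C Γ (threeRel a b c s t)))

-- Only feasibility matters: with no soft self-loop, a self-loop witness γ at (s,t) is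
-- feasible at (s,t) and (t,s) but at neither (s,s) nor (t,t). Conjugating γ by a binary
-- relation R of C(Γ), i.e. forming R ; γ ; Rᵀ with two joins, transports this pattern to
-- (x,y) whenever R(x,s), R(y,t) are feasible and s is the only partner of x in R.
-- For ab|c with witness (s,t), R = {(a,s),(b,s),(c,t)} gives (a,c),(b,c) ∈ M̄. If also
-- ca|b with witness (s',t'), the join ρ = Rᵀ ; R' has the partners ρ(t,s'), ρ(s,t'),
-- ρ(s,s'), and t has s' as its only partner; conjugating the witness of (s',t') by ρ
-- yields a self-loop at (t,s) that is feasible at (s,s), i.e. a soft one.
module Submission where

open import Defs
open import Data.Nat using (ℕ)
open import Data.Fin using (Fin; _≟_)
open import Data.Bool using (T; true; false; if_then_else_; _∧_)
open import Data.Bool.Properties using (T-∨; T-∧)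
open import Data.List using (_∷_; foldr)
open import Data.List.Relation.Unary.Any using (Any; here; there; satisfied)
open import Data.List.Relation.Unary.Any.Properties using (tabulate⁺)
open import Data.Product using (_×_; _,_; proj₁; ∃; ∃₂)
open import Data.Sum using (_⊎_; inj₁; inj₂)
open import Data.Empty using (⊥-elim)
open import Data.Unit using (tt)
open import Data.Rational using (0ℚ)
open import Function using (_∘_; id)
open import Function.Bundles using (_⇔_; mk⇔; Equivalence)
open import Function.Properties.Equivalence using () renaming (trans to ⇔-trans)
open import Data.Sum.Function.Propositional using (_⊎-⇔_)
open import Data.Product.Function.NonDependent.Propositional using (_×-⇔_)
open import Relation.Nullary using (¬_)
open import Relation.Nullary.Decidable using (⌊_⌋; toWitness; fromWitness)
open import Relation.Binary.PropositionalEquality using (_≡_; _≢_; refl; sym; subst₂)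

private
  variable
    n : ℕ

⊕-finite⁺ : ∀ {x y} → IsFinite x → IsFinite y → IsFinite (x ⊕ y)
⊕-finite⁺ {fin _} {fin _} _ _ = tt

⊕-finite⁻ : ∀ {x y} → IsFinite (x ⊕ y) → IsFinite x × IsFinite y
⊕-finite⁻ {fin _} {fin _} _ = tt , tt

minE-finite⁺ : ∀ {x y} → IsFinite x ⊎ IsFinite y → IsFinite (minE x y)
minE-finite⁺ {fin _} {fin _} _         = tt
minE-finite⁺ {fin _} {∞}     _         = tt
minE-finite⁺ {∞}             (inj₂ fy) = fy

minE-finite⁻ : ∀ {x y} → IsFinite (minE x y) → IsFinite x ⊎ IsFinite y
minE-finite⁻ {fin _} _  = inj₁ tt
minE-finite⁻ {∞}     fy = inj₂ fy

finite<E-infinite : ∀ {x y} → IsFinite x → ¬ IsFinite y → x <E y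
finite<E-infinite {fin _} {fin _} _ ¬fy = ⊥-elim (¬fy tt)
finite<E-infinite {fin _} {∞}     _ _   = tt

module _ (f : Fin n → Ext) where

  foldr-minE-finite⁺ : ∀ {xs} → Any (IsFinite ∘ f) xs →
                       IsFinite (foldr (λ d acc → minE (f d) acc) ∞ xs)
  foldr-minE-finite⁺ (here fx)  = minE-finite⁺ (inj₁ fx)
  foldr-minE-finite⁺ (there fx) = minE-finite⁺ (inj₂ (foldr-minE-finite⁺ fx))

  foldr-minE-finite⁻ : ∀ xs → IsFinite (foldr (λ d acc → minE (f d) acc) ∞ xs) →
                       Any (IsFinite ∘ f) xs
  foldr-minE-finite⁻ (x ∷ xs) h with minE-finite⁻ {f x} h
  ... | inj₁ fx = here fx
  ... | inj₂ fr = there (foldr-minE-finite⁻ xs fr)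

  minOver-finite⁺ : ∀ d → IsFinite (f d) → IsFinite (minOver f)
  minOver-finite⁺ d = foldr-minE-finite⁺ ∘ tabulate⁺ d

  minOver-finite⁻ : IsFinite (minOver f) → ∃ (IsFinite ∘ f)
  minOver-finite⁻ = satisfied ∘ foldr-minE-finite⁻ (allFin n)

-- A record rather than a synonym, so that γ, x and y can be inferred from a proof.
record Feasible (γ : WRel n 2) (x y : Fin n) : Set where
  constructor feasible
  field isFinite : IsFinite (app2 γ x y)

open Feasible

-- γ₁ ; γ₂, γ₁ᵀ ; γ₂ and R ; γ ; Rᵀ as joins.
compose : WRel n 2 → WRel n 2 → WRel n 2
compose = join false true

converseCompose : WRel n 2 → WRel n 2 → WRel n 2
converseCompose = join true true

conjugate : WRel n 2 → WRel n 2 → WRel n 2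
conjugate R γ = join false false (compose R γ) R

join-feasible⁺ : ∀ o₁ o₂ (γ₁ γ₂ : WRel n 2) {x y} z →
                 IsFinite (app2o o₁ γ₁ x z) → IsFinite (app2o o₂ γ₂ y z) →
                 Feasible (join o₁ o₂ γ₁ γ₂) x y
join-feasible⁺ o₁ o₂ _ _ z f₁ f₂ = feasible (minOver-finite⁺ _ z (⊕-finite⁺ f₁ f₂))

join-feasible⁻ : ∀ o₁ o₂ (γ₁ γ₂ : WRel n 2) {x y} → Feasible (join o₁ o₂ γ₁ γ₂) x y →
                 ∃ λ z → IsFinite (app2o o₁ γ₁ x z) × IsFinite (app2o o₂ γ₂ y z)
join-feasible⁻ o₁ o₂ _ _ (feasible h) with minOver-finite⁻ _ h
... | z , fz = z , ⊕-finite⁻ fz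

compose-feasible⁺ : ∀ {γ₁ γ₂ : WRel n 2} {x y} z →
                    Feasible γ₁ x z → Feasible γ₂ z y → Feasible (compose γ₁ γ₂) x y
compose-feasible⁺ {γ₁ = γ₁} {γ₂} z (feasible f₁) (feasible f₂) =
  join-feasible⁺ false true γ₁ γ₂ z f₁ f₂

compose-feasible⁻ : ∀ {γ₁ γ₂ : WRel n 2} {x y} → Feasible (compose γ₁ γ₂) x y →
                    ∃ λ z → Feasible γ₁ x z × Feasible γ₂ z y
compose-feasible⁻ {γ₁ = γ₁} {γ₂} h with join-feasible⁻ false true γ₁ γ₂ h
... | z , f₁ , f₂ = z , feasible f₁ , feasible f₂

converseCompose-feasible⁺ : ∀ {γ₁ γ₂ : WRel n 2} {x y} z →
                            Feasible γ₁ z x → Feasible γ₂ z y →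
                            Feasible (converseCompose γ₁ γ₂) x y
converseCompose-feasible⁺ {γ₁ = γ₁} {γ₂} z (feasible f₁) (feasible f₂) =
  join-feasible⁺ true true γ₁ γ₂ z f₁ f₂

converseCompose-feasible⁻ : ∀ {γ₁ γ₂ : WRel n 2} {x y} →
                            Feasible (converseCompose γ₁ γ₂) x y →
                            ∃ λ z → Feasible γ₁ z x × Feasible γ₂ z y
converseCompose-feasible⁻ {γ₁ = γ₁} {γ₂} h with join-feasible⁻ true true γ₁ γ₂ h
... | z , f₁ , f₂ = z , feasible f₁ , feasible f₂

conjugate-feasible⁺ : ∀ {R γ : WRel n 2} {x y} w z →
                      Feasible R x w → Feasible γ w z → Feasible R y z →
                      Feasible (conjugate R γ) x y
conjugate-feasible⁺ {R = R} {γ} w z Rxw γwz (feasible Ryz) =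
  join-feasible⁺ false false (compose R γ) R z (isFinite (compose-feasible⁺ w Rxw γwz)) Ryz

conjugate-feasible⁻ : ∀ {R γ : WRel n 2} {x y} → Feasible (conjugate R γ) x y →
                      ∃₂ λ w z → Feasible R x w × Feasible γ w z × Feasible R y z
conjugate-feasible⁻ {R = R} {γ} h with join-feasible⁻ false false (compose R γ) R h
... | z , Rγxz , Ryz with compose-feasible⁻ {γ₁ = R} {γ} (feasible Rγxz)
... | w , Rxw , γwz = w , z , Rxw , γwz , feasible Ryz

conjugate-antidiagonal :
  ∀ {R γ : WRel n 2} {x y s t} →
  Feasible γ s t → Feasible γ t s → ¬ Feasible γ s s →
  Feasible R x s → Feasible R y t → (∀ {w} → Feasible R x w → w ≡ s) →
  Feasible (conjugate R γ) x y × Feasible (conjugate R γ) y x ×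
  ¬ Feasible (conjugate R γ) x x
conjugate-antidiagonal {γ = γ} {s = s} {t} γst γts ¬γss Rxs Ryt only-s =
  conjugate-feasible⁺ s t Rxs γst Ryt ,
  conjugate-feasible⁺ t s Ryt γts Rxs ,
  λ h → let w , z , Rxw , γwz , Rxz = conjugate-feasible⁻ h in
        ¬γss (subst₂ (Feasible γ) (only-s Rxw) (only-s Rxz) γwz)

antidiagonal⇒edgeWitness : ∀ {δ : WRel n 2} {x y} →
                           Feasible δ x y → Feasible δ y x → ¬ Feasible δ x x →
                           EdgeWitness δ x y x y
antidiagonal⇒edgeWitness (feasible xy) (feasible yx) ¬xx =
  xy , yx , finite<E-infinite (⊕-finite⁺ xy yx) (¬xx ∘ feasible ∘ proj₁ ∘ ⊕-finite⁻)

feasible-if : ∀ {B} → IsFinite (if B then fin 0ℚ else ∞) ⇔ T B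
feasible-if {true}  = mk⇔ id id
feasible-if {false} = mk⇔ id id

threeRel-feasible : ∀ {a b c s t x y : Fin n} →
                    Feasible (threeRel a b c s t) x y ⇔
                    ((x ≡ a × y ≡ s) ⊎ (x ≡ b × y ≡ s) ⊎ (x ≡ c × y ≡ t))
threeRel-feasible {a = a} {b} {c} {s} {t} =
  ⇔-trans (mk⇔ isFinite feasible)
  (⇔-trans feasible-if
  (⇔-trans T-∨ (at a s ⊎-⇔ ⇔-trans T-∨ (at b s ⊎-⇔ at c t))))
  where
  is : ∀ {x u : Fin n} → T ⌊ x ≟ u ⌋ ⇔ x ≡ u
  is = mk⇔ toWitness fromWitness

  at : ∀ {x y} u v → T (⌊ x ≟ u ⌋ ∧ ⌊ y ≟ v ⌋) ⇔ (x ≡ u × y ≡ v)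
  at u v = ⇔-trans T-∧ (is ×-⇔ is)

module _ {a b c s t : Fin n} where

  private
    R = threeRel a b c s t

  threeRel-feasible⁺ : ∀ {x y} → (x ≡ a × y ≡ s) ⊎ (x ≡ b × y ≡ s) ⊎ (x ≡ c × y ≡ t) →
                       Feasible R x y
  threeRel-feasible⁺ = Equivalence.from threeRel-feasible

  threeRel-partner-unique : ∀ {x w} → x ≢ c → Feasible R x w → w ≡ s
  threeRel-partner-unique x≢c h with Equivalence.to threeRel-feasible h
  ... | inj₁ (_ , w≡s)        = w≡s
  ... | inj₂ (inj₁ (_ , w≡s)) = w≡s
  ... | inj₂ (inj₂ (x≡c , _)) = ⊥-elim (x≢c x≡c)

  threeRel-source-of-t : ∀ {z} → s ≢ t → Feasible R z t → z ≡ c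
  threeRel-source-of-t s≢t h with Equivalence.to threeRel-feasible h
  ... | inj₁ (_ , t≡s)        = ⊥-elim (s≢t (sym t≡s))
  ... | inj₂ (inj₁ (_ , t≡s)) = ⊥-elim (s≢t (sym t≡s))
  ... | inj₂ (inj₂ (z≡c , _)) = z≡c

module _ {Γ : Language n} (noSoft : NoSoftSelfLoop Γ) where

  selfLoop-diagonal-infeasible : ∀ {γ s t} → C Γ γ → s ≢ t → EdgeWitness γ s t s t →
                                 ¬ Feasible γ s s
  selfLoop-diagonal-infeasible Cγ s≢t w (feasible ss) =
    noSoft _ _ (s≢t , s≢t , _ , Cγ , w , inj₁ ss)

  selfLoop-conjugate :
    ∀ {R : WRel n 2} {s t x y} → C Γ R → InMbar Γ s t →
    Feasible R x s → Feasible R y t → (∀ {w} → Feasible R x w → w ≡ s) →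
    ∃ λ δ → C Γ δ × EdgeWitness δ x y x y × (Feasible R y s → Feasible δ y y)
  selfLoop-conjugate {R} {s} {t} CR (s≢t , _ , γ , Cγ , w@(γst , γts , _)) Rxs Ryt only-s
    with conjugate-antidiagonal (feasible γst) (feasible γts)
           (selfLoop-diagonal-infeasible Cγ s≢t w) Rxs Ryt only-s
  ... | δxy , δyx , ¬δxx =
    conjugate R γ ,
    joinC (joinC CR Cγ false true) CR false false ,
    antidiagonal⇒edgeWitness δxy δyx ¬δxx ,
    λ Rys → conjugate-feasible⁺ {γ = γ} s t Rys (feasible γst) Ryt

  split⇒inMbar : ∀ {a b c} → Split Γ a b c → InMbar Γ a c × InMbar Γ b c
  split⇒inMbar {a} {b} {c} (_ , b≢c , a≢c , s , t , m , CR) =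
    inMbar a≢c (threeRel-feasible⁺ (inj₁ (refl , refl))) ,
    inMbar b≢c (threeRel-feasible⁺ (inj₂ (inj₁ (refl , refl))))
    where
    inMbar : ∀ {x} → x ≢ c → Feasible (threeRel a b c s t) x s → InMbar Γ x c
    inMbar x≢c Rxs =
      let δ , Cδ , w , _ = selfLoop-conjugate CR m Rxs
                             (threeRel-feasible⁺ (inj₂ (inj₂ (refl , refl))))
                             (threeRel-partner-unique x≢c)
      in x≢c , x≢c , δ , Cδ , w

  split-exclusive : ∀ {a b c} → Split Γ a b c → ¬ Split Γ c a b
  split-exclusive {a} {b} {c} (_ , b≢c , _ , s , t , (s≢t , _) , CR₁)
                              (_ , _ , _ , s′ , t′ , m′ , CR₂) =
    let δ , Cδ , w , soft = selfLoop-conjugate (joinC CR₁ CR₂ true true) m′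
                              ρts′ ρst′ partner-of-t
    in noSoft t s (t≢s , t≢s , δ , Cδ , w , inj₂ (isFinite (soft ρss′)))
    where
    R₁ = threeRel a b c s t
    R₂ = threeRel c a b s′ t′
    ρ = converseCompose R₁ R₂

    t≢s : t ≢ s
    t≢s = s≢t ∘ sym

    ρts′ : Feasible ρ t s′
    ρts′ = converseCompose-feasible⁺ {γ₁ = R₁} {R₂} c
             (threeRel-feasible⁺ (inj₂ (inj₂ (refl , refl))))
             (threeRel-feasible⁺ (inj₁ (refl , refl)))

    ρst′ : Feasible ρ s t′
    ρst′ = converseCompose-feasible⁺ {γ₁ = R₁} {R₂} b
             (threeRel-feasible⁺ (inj₂ (inj₁ (refl , refl))))
             (threeRel-feasible⁺ (inj₂ (inj₂ (refl , refl))))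

    ρss′ : Feasible ρ s s′
    ρss′ = converseCompose-feasible⁺ {γ₁ = R₁} {R₂} a
             (threeRel-feasible⁺ (inj₁ (refl , refl)))
             (threeRel-feasible⁺ (inj₂ (inj₁ (refl , refl))))

    partner-of-t : ∀ {v} → Feasible ρ t v → v ≡ s′
    partner-of-t h with converseCompose-feasible⁻ {γ₁ = R₁} {R₂} h
    ... | z , R₁zt , R₂zv with threeRel-source-of-t s≢t R₁zt
    ... | refl = threeRel-partner-unique (b≢c ∘ sym) R₂zv

lemma4p15 : (n : ℕ) (Γ : Language n) → Conservative Γ → NoSoftSelfLoop Γ →
    (a b c : Fin n) →
    (¬ (Split Γ a b c × Split Γ c a b) × ¬ (Split Γ c a b × Split Γ b c a) ×
     ¬ (Split Γ a b c × Split Γ b c a)) ×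
    (Split Γ a b c → InMbar Γ a c × InMbar Γ b c)
lemma4p15 n Γ _ noSoft a b c =
  ( (λ (abc , cab) → split-exclusive noSoft abc cab)
  , (λ (cab , bca) → split-exclusive noSoft cab bca)
  , (λ (abc , bca) → split-exclusive noSoft bca abc) )
  , split⇒inMbar noSoft
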